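{- Let $n\ge4$. (i) For distinct natural numbers $a,b$ with $1\le a,b\le n-2$ and $a+b=n-1$, the necklaces $[a,b,n,b,a,n]$ and $[a,b,n-1,b,a,n-1]$ are topdrop-valid in $S_n$. (ii) For distinct natural numbers $a,b$ with $1\le a,b\le n-2$ and $a+b\ne n-1$, the necklace $[a,b,n-1,b,a,n]$ is topdrop-valid in $S_n$.
   Context: Permutations are in one-line notation $\pi=\pi_1\cdots\pi_n$. The topdrop map $T:S_n\to S_n$ is $T(\pi_1\cdots\pi_n)=\pi_{\pi_1+1}\cdots\pi_n\,\pi_{\pi_1}\pi_{\pi_1-1}\cdots\pi_1$ (first $\pi_1$ entries removed, reversed, appended at the end); it is a bijection. The orbit of $\pi$ is $(\pi,T(\pi),\dots,T^{s-1}(\pi))$ with $s\ge1$ minimal such that $T^s(\pi)=\pi$. The topdrop-necklace of $\pi$ is the cyclic sequence $[\pi_1,T(\pi)_1,\dots,T^{s-1}(\pi)_1]$, considered up to cyclic rotation; its size is $s$. A necklace is topdrop-valid in $S_n$ if it is the topdrop-necklace of some $\pi\in S_n$. -}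

module Defs where

open import Data.Nat using (ℕ; zero; suc; _≤_; _<_)
open import Data.List using (List; []; _∷_; _++_; take; drop; reverse; map; upTo)
open import Data.List.Relation.Binary.Permutation.Propositional using (_↭_)
open import Data.Product using (Σ; _×_; ∃)
open import Relation.Binary.PropositionalEquality using (_≡_; _≢_)

IsPermOf : ℕ → List ℕ → Set
IsPermOf n π = π ↭ map suc (upTo n)

-- First entry (default 0 for the empty list; never used on S_n with n ≥ 1).
hd : List ℕ → ℕ
hd []      = 0
hd (x ∷ _) = x

topdrop : List ℕ → List ℕ
topdrop π = drop (hd π) π ++ reverse (take (hd π) π)

topdrop^ : ℕ → List ℕ → List ℕ
topdrop^ zero    π = π
topdrop^ (suc k) π = topdrop (topdrop^ k π)

IsOrbitSize : List ℕ → ℕ → Set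
IsOrbitSize π s = (1 ≤ s) × (topdrop^ s π ≡ π) × (∀ t → 1 ≤ t → t < s → topdrop^ t π ≢ π)

necklaceSeq : List ℕ → ℕ → List ℕ
necklaceSeq π s = map (λ i → hd (topdrop^ i π)) (upTo s)

rotate : ℕ → List ℕ → List ℕ
rotate k xs = drop k xs ++ take k xs

-- The necklace w (given by a representative sequence) is topdrop-valid in S_n:
-- it equals, up to cyclic rotation, the topdrop-necklace of some π ∈ S_n.
TopdropValid : ℕ → List ℕ → Set
TopdropValid n w =
  ∃ λ π → IsPermOf n π × ∃ λ s → IsOrbitSize π s ×
    ∃ λ k → (k < s) × (rotate k (necklaceSeq π s) ≡ w)

{-# OPTIONS --safe #-}
module Submission where

-- Each necklace is the head sequence of an explicit permutation whose topdrop orbit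
-- has length 6; the remaining values fill the blocks A, B, … in any order, and Aʳ is A reversed.
-- (i)  π = a A b B x with |A| = a - 1, |B| = b - 1 and x ∈ {n - 1, n}:
--        π ↦ b B x Aʳ a ↦ x Aʳ a Bʳ b ↦ b B a A x ↦ a A x Bʳ b ↦ x Bʳ b Aʳ a ↦ π,
--      where at the third and sixth step flipping n - 1 or n entries gives the same result.
-- (ii) If a + b < n - 1 take π = a A b B (n-1) C n, and if a + b > n - 1 take
--      π = a M (n-1) D b K n, the block D of length a + b - n being shared by the
--      first a and the first b entries. Both orbits have heads a b (n-1) b a n.
-- The orbit length is exactly 6 because in each case the head word has no shorter period.

open import Defs
open import Data.Nat using (ℕ; zero; suc; _≤_; _<_; _+_; _∸_; z≤n; s≤s)
open import Data.Nat.Properties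
  using ( +-identityʳ; +-comm; +-assoc; +-suc; +-cancelˡ-≡; suc-injective; <-cmp
        ; ≤-refl; n≤1+n; n<1+n; m<n⇒m<1+n; m≤n⇒m≤1+n; m≤n⇒m≤o+n; ≤-<-trans; <⇒≢; >⇒≢
        ; m≤n⇒∃[o]m+o≡n )
open import Data.Nat.Tactic.RingSolver using (solve-∀)
open import Data.List using (List; []; _∷_; _++_; [_]; length; take; drop; reverse; map; upTo; concatMap)
open import Data.List.Properties
  using ( ++-identityʳ; length-++; length-reverse; length-map; length-upTo
        ; reverse-++; reverse-involutive; unfold-reverse; concatMap-++ )
open import Data.List.Membership.Propositional using (_∈_)
open import Data.List.Membership.Propositional.Properties using (∈-∃++; ∈-map⁺; ∈-upTo⁺)
open import Data.List.Relation.Unary.All as All using (All; []; _∷_)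
open import Data.List.Relation.Unary.AllPairs using ([]; _∷_)
open import Data.List.Relation.Unary.Any using (here; there)
open import Data.List.Relation.Unary.Unique.Propositional using (Unique)
open import Data.List.Relation.Binary.Permutation.Propositional using (_↭_; prep; ↭-refl; ↭-sym; ↭-trans)
open import Data.List.Relation.Binary.Permutation.Propositional.Properties
  using (shift; ∈-resp-↭; ↭-length; ++-commutativeMonoid)
open import Algebra.Solver.CommutativeMonoid (++-commutativeMonoid {A = ℕ}) using (solve; _⊜_; _⊕_)
open import Data.Empty using (⊥-elim)
open import Data.Product as Product using (∃; ∃₂; _×_; _,_)
open import Data.Sum as Sum using (_⊎_; inj₁; inj₂)
open import Function using (_∘_)
open import Relation.Binary.Definitions using (tri<; tri≈; tri>)
open import Relation.Binary.PropositionalEquality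
  using (_≡_; _≢_; refl; sym; trans; cong; cong₂; module ≡-Reasoning)
open import Relation.Nullary using (contradiction)

module _ {A : Set} where

  drop-length-++ : ∀ (xs ys : List A) → drop (length xs) (xs ++ ys) ≡ ys
  drop-length-++ []       ys = refl
  drop-length-++ (x ∷ xs) ys = drop-length-++ xs ys

  take-length-++ : ∀ (xs ys : List A) → take (length xs) (xs ++ ys) ≡ xs
  take-length-++ []       ys = refl
  take-length-++ (x ∷ xs) ys = cong (x ∷_) (take-length-++ xs ys)

  split-length : ∀ (xs : List A) k m → length xs ≡ k + m →
                 ∃₂ λ ys zs → xs ≡ ys ++ zs × length ys ≡ k × length zs ≡ m
  split-length xs       zero    m refl = [] , xs , refl , refl , refl
  split-length (x ∷ xs) (suc k) m eq
    with ys , zs , refl , refl , refl ← split-length xs k m (suc-injective eq)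
    = x ∷ ys , zs , refl , refl , refl

  ∈⇒∷-↭ : ∀ {x : A} {xs} → x ∈ xs → ∃ λ ys → x ∷ ys ↭ xs
  ∈⇒∷-↭ {x} x∈xs with ys , zs , refl ← ∈-∃++ x∈xs = ys ++ zs , ↭-sym (shift x ys zs)

  ∈-∷-≢ : ∀ {j k : A} {ys} → j ∈ k ∷ ys → k ≢ j → j ∈ ys
  ∈-∷-≢ (here j≡k)    k≢j = ⊥-elim (k≢j (sym j≡k))
  ∈-∷-≢ (there j∈ys) _   = j∈ys

  unique-⊆⇒++-↭ : ∀ {ks xs : List A} → Unique ks → All (_∈ xs) ks → ∃ λ ys → ks ++ ys ↭ xs
  unique-⊆⇒++-↭ {xs = xs} [] [] = xs , ↭-refl
  unique-⊆⇒++-↭ {k ∷ ks} (k≢ks ∷ ks-unique) (k∈xs ∷ ks⊆xs)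
    with rest , k∷rest↭xs ← ∈⇒∷-↭ k∈xs
    with ys , ks++ys↭rest ← unique-⊆⇒++-↭ ks-unique
           (All.zipWith (λ (k≢j , j∈xs) → ∈-∷-≢ (∈-resp-↭ (↭-sym k∷rest↭xs) j∈xs) k≢j) (k≢ks , ks⊆xs))
    = ys , ↭-trans (prep k ks++ys↭rest) k∷rest↭xs

topdrop-∷-++ : ∀ u (xs ys : List ℕ) → u ≡ suc (length xs) →
               topdrop (u ∷ xs ++ ys) ≡ ys ++ reverse xs ++ [ u ]
topdrop-∷-++ u xs ys refl = cong₂ _++_ (drop-length-++ xs ys) (begin
  reverse (u ∷ take (length xs) (xs ++ ys)) ≡⟨ cong (λ zs → reverse (u ∷ zs)) (take-length-++ xs ys) ⟩
  reverse (u ∷ xs)                          ≡⟨ unfold-reverse u xs ⟩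
  reverse xs ++ [ u ]                       ∎)
  where open ≡-Reasoning

-- Words are written as concatenations of blocks read forwards or backwards; by
-- topdrop-blocks each orbit step is then a computation on block lists, up to a length condition.
data Block : Set where
  fwd bwd : List ℕ → Block

⟦_⟧ᵇ : Block → List ℕ
⟦ fwd xs ⟧ᵇ = xs
⟦ bwd xs ⟧ᵇ = reverse xs

flipᵇ : Block → Block
flipᵇ (fwd xs) = bwd xs
flipᵇ (bwd xs) = fwd xs

⟦_⟧ : List Block → List ℕ
⟦_⟧ = concatMap ⟦_⟧ᵇ

width : List Block → ℕ
width []            = 0
width (fwd xs ∷ bs) = length xs + width bs
width (bwd xs ∷ bs) = length xs + width bs

mirror : List Block → List Block
mirror []       = []
mirror (b ∷ bs) = mirror bs ++ [ flipᵇ b ]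

length-⟦⟧ : ∀ bs → length ⟦ bs ⟧ ≡ width bs
length-⟦⟧ []            = refl
length-⟦⟧ (fwd xs ∷ bs) = trans (length-++ xs) (cong (length xs +_) (length-⟦⟧ bs))
length-⟦⟧ (bwd xs ∷ bs) = trans (length-++ (reverse xs)) (cong₂ _+_ (length-reverse xs) (length-⟦⟧ bs))

⟦flipᵇ⟧ : ∀ b → ⟦ flipᵇ b ⟧ᵇ ≡ reverse ⟦ b ⟧ᵇ
⟦flipᵇ⟧ (fwd xs) = refl
⟦flipᵇ⟧ (bwd xs) = sym (reverse-involutive xs)

reverse-⟦⟧ : ∀ bs → reverse ⟦ bs ⟧ ≡ ⟦ mirror bs ⟧
reverse-⟦⟧ []       = refl
reverse-⟦⟧ (b ∷ bs) = begin
  reverse (⟦ b ⟧ᵇ ++ ⟦ bs ⟧)            ≡⟨ reverse-++ ⟦ b ⟧ᵇ ⟦ bs ⟧ ⟩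
  reverse ⟦ bs ⟧ ++ reverse ⟦ b ⟧ᵇ      ≡⟨ cong₂ _++_ (reverse-⟦⟧ bs) (sym (⟦flipᵇ⟧ b)) ⟩
  ⟦ mirror bs ⟧ ++ ⟦ flipᵇ b ⟧ᵇ         ≡⟨ cong (⟦ mirror bs ⟧ ++_) (sym (++-identityʳ _)) ⟩
  ⟦ mirror bs ⟧ ++ ⟦ [ flipᵇ b ] ⟧      ≡⟨ concatMap-++ ⟦_⟧ᵇ (mirror bs) _ ⟨
  ⟦ mirror bs ++ [ flipᵇ b ] ⟧          ∎
  where open ≡-Reasoning

topdrop-blocks : ∀ u us vs → u ≡ suc (width us) →
                 topdrop (u ∷ ⟦ us ++ vs ⟧) ≡ ⟦ vs ++ mirror us ++ [ fwd [ u ] ] ⟧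
topdrop-blocks u us vs u≡ = begin
  topdrop (u ∷ ⟦ us ++ vs ⟧)               ≡⟨ cong (λ xs → topdrop (u ∷ xs)) (concatMap-++ ⟦_⟧ᵇ us vs) ⟩
  topdrop (u ∷ ⟦ us ⟧ ++ ⟦ vs ⟧)           ≡⟨ topdrop-∷-++ u ⟦ us ⟧ ⟦ vs ⟧ (trans u≡ (cong suc (sym (length-⟦⟧ us)))) ⟩
  ⟦ vs ⟧ ++ reverse ⟦ us ⟧ ++ [ u ]        ≡⟨ cong (λ xs → ⟦ vs ⟧ ++ xs ++ [ u ]) (reverse-⟦⟧ us) ⟩
  ⟦ vs ⟧ ++ ⟦ mirror us ⟧ ++ [ u ]         ≡⟨ cong (⟦ vs ⟧ ++_) (concatMap-++ ⟦_⟧ᵇ (mirror us) _) ⟨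
  ⟦ vs ⟧ ++ ⟦ mirror us ++ [ fwd [ u ] ] ⟧ ≡⟨ concatMap-++ ⟦_⟧ᵇ vs _ ⟨
  ⟦ vs ++ mirror us ++ [ fwd [ u ] ] ⟧     ∎
  where open ≡-Reasoning

topdrop-fwd : ∀ u xs vs → u ≡ suc (length xs) → topdrop (u ∷ xs ++ ⟦ vs ⟧) ≡ ⟦ vs ++ bwd xs ∷ fwd [ u ] ∷ [] ⟧
topdrop-fwd u xs vs u≡ = topdrop-blocks u [ fwd xs ] vs (trans u≡ (cong suc (sym (+-identityʳ _))))

-- Flipping all but the final d, or the whole word, gives the same result.
topdrop-ends : ∀ {c d x} (C D : List ℕ) → c ≡ suc (length C) → d ≡ suc (length D) →
  x ≡ c + d ⊎ x ≡ suc (c + d) → topdrop (x ∷ reverse C ++ c ∷ reverse D ++ [ d ]) ≡ d ∷ D ++ c ∷ C ++ [ x ]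
topdrop-ends C D refl refl (inj₁ refl) =
  topdrop-blocks _ (bwd C ∷ fwd [ _ ] ∷ bwd D ∷ []) [ fwd [ _ ] ] (width₃ (length C) (length D))
  where
  width₃ : ∀ γ δ → suc γ + suc δ ≡ suc (γ + suc (δ + 0))
  width₃ = solve-∀
topdrop-ends C D refl refl (inj₂ refl) =
  topdrop-blocks _ (bwd C ∷ fwd [ _ ] ∷ bwd D ∷ fwd [ _ ] ∷ []) [] (width₄ (length C) (length D))
  where
  width₄ : ∀ γ δ → suc (suc γ + suc δ) ≡ suc (γ + suc (δ + suc 0))
  width₄ = solve-∀

topdrop^-+ : ∀ i t π → topdrop^ (i + t) π ≡ topdrop^ i (topdrop^ t π)
topdrop^-+ zero    t π = refl
topdrop^-+ (suc i) t π = cong topdrop (topdrop^-+ i t π)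

heads-periodic : ∀ {π} t → topdrop^ t π ≡ π → ∀ i → hd (topdrop^ (i + t) π) ≡ hd (topdrop^ i π)
heads-periodic {π} t Tᵗπ≡π i = cong hd (trans (topdrop^-+ i t π) (cong (topdrop^ i) Tᵗπ≡π))

-- The head inequalities exclude the periods t = 1, 2, 3, 5 by comparing heads 0 and t,
-- and t = 4 by comparing heads 1 and 5.
six-cycle⇒valid : ∀ {n} p₀ p₁ p₂ p₃ p₄ p₅ → IsPermOf n p₀ →
  topdrop p₀ ≡ p₁ → topdrop p₁ ≡ p₂ → topdrop p₂ ≡ p₃ →
  topdrop p₃ ≡ p₄ → topdrop p₄ ≡ p₅ → topdrop p₅ ≡ p₀ →
  hd p₁ ≢ hd p₀ → hd p₂ ≢ hd p₀ → hd p₃ ≢ hd p₀ → hd p₅ ≢ hd p₁ → hd p₅ ≢ hd p₀ →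
  TopdropValid n (hd p₀ ∷ hd p₁ ∷ hd p₂ ∷ hd p₃ ∷ hd p₄ ∷ hd p₅ ∷ [])
six-cycle⇒valid p₀ p₁ p₂ p₃ p₄ p₅ perm s₀ s₁ s₂ s₃ s₄ s₅ h₁ h₂ h₃ h₅₁ h₅ =
  p₀ , perm , 6 , (s≤s z≤n , T⁶ , minimal) , 0 , s≤s z≤n , heads
  where
  T¹ : topdrop^ 1 p₀ ≡ p₁
  T¹ = s₀
  T² : topdrop^ 2 p₀ ≡ p₂
  T² = trans (cong topdrop T¹) s₁
  T³ : topdrop^ 3 p₀ ≡ p₃
  T³ = trans (cong topdrop T²) s₂
  T⁴ : topdrop^ 4 p₀ ≡ p₄
  T⁴ = trans (cong topdrop T³) s₃
  T⁵ : topdrop^ 5 p₀ ≡ p₅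
  T⁵ = trans (cong topdrop T⁴) s₄
  T⁶ : topdrop^ 6 p₀ ≡ p₀
  T⁶ = trans (cong topdrop T⁵) s₅
  minimal : ∀ t → 1 ≤ t → t < 6 → topdrop^ t p₀ ≢ p₀
  minimal 1 _ _ e = h₁ (trans (cong hd (sym T¹)) (heads-periodic 1 e 0))
  minimal 2 _ _ e = h₂ (trans (cong hd (sym T²)) (heads-periodic 2 e 0))
  minimal 3 _ _ e = h₃ (trans (cong hd (sym T³)) (heads-periodic 3 e 0))
  minimal 4 _ _ e = h₅₁ (trans (cong hd (sym T⁵)) (trans (heads-periodic 4 e 1) (cong hd T¹)))
  minimal 5 _ _ e = h₅ (trans (cong hd (sym T⁵)) (heads-periodic 5 e 0))
  minimal (suc (suc (suc (suc (suc (suc _)))))) _ (s≤s (s≤s (s≤s (s≤s (s≤s (s≤s ())))))) _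
  heads : rotate 0 (necklaceSeq p₀ 6) ≡ hd p₀ ∷ hd p₁ ∷ hd p₂ ∷ hd p₃ ∷ hd p₄ ∷ hd p₅ ∷ []
  heads = cong (hd p₀ ∷_) (cong₂ _∷_ (cong hd T¹) (cong₂ _∷_ (cong hd T²)
            (cong₂ _∷_ (cong hd T³) (cong₂ _∷_ (cong hd T⁴) (cong₂ _∷_ (cong hd T⁵) refl)))))

abxbax-orbit : ∀ {n a b x} (A B : List ℕ) → a ≡ suc (length A) → b ≡ suc (length B) →
  x ≡ a + b ⊎ x ≡ suc (a + b) → a ≢ b → x ≢ a → x ≢ b →
  IsPermOf n (a ∷ A ++ b ∷ B ++ [ x ]) → TopdropValid n (a ∷ b ∷ x ∷ b ∷ a ∷ x ∷ [])
abxbax-orbit {a = a} {b} {x} A B a≡ b≡ x≡ a≢b x≢a x≢b perm = six-cycle⇒valid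
  (a ∷ A ++ b ∷ B ++ [ x ])
  (b ∷ B ++ x ∷ reverse A ++ [ a ])
  (x ∷ reverse A ++ a ∷ reverse B ++ [ b ])
  (b ∷ B ++ a ∷ A ++ [ x ])
  (a ∷ A ++ x ∷ reverse B ++ [ b ])
  (x ∷ reverse B ++ b ∷ reverse A ++ [ a ])
  perm
  (topdrop-fwd a A (fwd [ b ] ∷ fwd B ∷ fwd [ x ] ∷ []) a≡)
  (topdrop-fwd b B (fwd [ x ] ∷ bwd A ∷ fwd [ a ] ∷ []) b≡)
  (topdrop-ends A B a≡ b≡ x≡)
  (topdrop-fwd b B (fwd [ a ] ∷ fwd A ∷ fwd [ x ] ∷ []) b≡)
  (topdrop-fwd a A (fwd [ x ] ∷ bwd B ∷ fwd [ b ] ∷ []) a≡)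
  (topdrop-ends B A b≡ a≡ (Sum.map (λ e → trans e (+-comm a b)) (λ e → trans e (cong suc (+-comm a b))) x≡))
  (a≢b ∘ sym) x≢a (a≢b ∘ sym) x≢b x≢a

abybaz-orbit-small : ∀ {n a b y z} (A B C : List ℕ) → a ≡ suc (length A) → b ≡ suc (length B) →
  y ≡ suc (a + b + length C) → z ≡ suc y → a ≢ b → y ≢ a → z ≢ a → z ≢ b →
  IsPermOf n (a ∷ A ++ b ∷ B ++ y ∷ C ++ [ z ]) → TopdropValid n (a ∷ b ∷ y ∷ b ∷ a ∷ z ∷ [])
abybaz-orbit-small {a = a} {b} {y} {z} A B C refl refl refl refl a≢b y≢a z≢a z≢b perm = six-cycle⇒valid
  (a ∷ A ++ b ∷ B ++ y ∷ C ++ [ z ])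
  (b ∷ B ++ y ∷ C ++ z ∷ reverse A ++ [ a ])
  (y ∷ C ++ z ∷ reverse A ++ a ∷ reverse B ++ [ b ])
  (b ∷ B ++ a ∷ A ++ z ∷ reverse C ++ [ y ])
  (a ∷ A ++ z ∷ reverse C ++ y ∷ reverse B ++ [ b ])
  (z ∷ reverse C ++ y ∷ reverse B ++ b ∷ reverse A ++ [ a ])
  perm
  (topdrop-fwd a A (fwd [ b ] ∷ fwd B ∷ fwd [ y ] ∷ fwd C ∷ fwd [ z ] ∷ []) refl)
  (topdrop-fwd b B (fwd [ y ] ∷ fwd C ∷ fwd [ z ] ∷ bwd A ∷ fwd [ a ] ∷ []) refl)
  (topdrop-blocks y (fwd C ∷ fwd [ z ] ∷ bwd A ∷ fwd [ a ] ∷ bwd B ∷ []) [ fwd [ b ] ]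
    (width-y (length A) (length B) (length C)))
  (topdrop-fwd b B (fwd [ a ] ∷ fwd A ∷ fwd [ z ] ∷ bwd C ∷ fwd [ y ] ∷ []) refl)
  (topdrop-fwd a A (fwd [ z ] ∷ bwd C ∷ fwd [ y ] ∷ bwd B ∷ fwd [ b ] ∷ []) refl)
  (topdrop-blocks z (bwd C ∷ fwd [ y ] ∷ bwd B ∷ fwd [ b ] ∷ bwd A ∷ fwd [ a ] ∷ []) []
    (width-z (length A) (length B) (length C)))
  (a≢b ∘ sym) y≢a (a≢b ∘ sym) z≢b z≢a
  where
  width-y : ∀ α β γ → suc (suc α + suc β + γ) ≡ suc (γ + suc (α + suc (β + 0)))
  width-y = solve-∀
  width-z : ∀ α β γ → suc (suc (suc α + suc β + γ)) ≡ suc (γ + suc (β + suc (α + suc 0)))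
  width-z = solve-∀

abybaz-orbit-large : ∀ {n a b y z} (M D K : List ℕ) → a ≡ suc (suc (length M + length D)) →
  b ≡ suc (suc (length K + length D)) → y ≡ suc (a + length K) → z ≡ suc y →
  a ≢ b → y ≢ a → z ≢ a → z ≢ b →
  IsPermOf n (a ∷ M ++ y ∷ D ++ b ∷ K ++ [ z ]) → TopdropValid n (a ∷ b ∷ y ∷ b ∷ a ∷ z ∷ [])
abybaz-orbit-large {a = a} {b} {y} {z} M D K refl refl refl refl a≢b y≢a z≢a z≢b perm = six-cycle⇒valid
  (a ∷ M ++ y ∷ D ++ b ∷ K ++ [ z ])
  (b ∷ K ++ z ∷ reverse D ++ y ∷ reverse M ++ [ a ])
  (y ∷ reverse M ++ a ∷ D ++ z ∷ reverse K ++ [ b ])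
  (b ∷ K ++ z ∷ reverse D ++ a ∷ M ++ [ y ])
  (a ∷ M ++ y ∷ D ++ z ∷ reverse K ++ [ b ])
  (z ∷ reverse K ++ b ∷ reverse D ++ y ∷ reverse M ++ [ a ])
  perm
  (topdrop-blocks a (fwd M ∷ fwd [ y ] ∷ fwd D ∷ []) (fwd [ b ] ∷ fwd K ∷ fwd [ z ] ∷ []) width-a)
  (topdrop-blocks b (fwd K ∷ fwd [ z ] ∷ bwd D ∷ []) (fwd [ y ] ∷ bwd M ∷ fwd [ a ] ∷ []) width-b)
  (topdrop-blocks y (bwd M ∷ fwd [ a ] ∷ fwd D ∷ fwd [ z ] ∷ bwd K ∷ []) [ fwd [ b ] ]
    (width-y (length M) (length D) (length K)))
  (topdrop-blocks b (fwd K ∷ fwd [ z ] ∷ bwd D ∷ []) (fwd [ a ] ∷ fwd M ∷ fwd [ y ] ∷ []) width-b)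
  (topdrop-blocks a (fwd M ∷ fwd [ y ] ∷ fwd D ∷ []) (fwd [ z ] ∷ bwd K ∷ fwd [ b ] ∷ []) width-a)
  (topdrop-blocks z (bwd K ∷ fwd [ b ] ∷ bwd D ∷ fwd [ y ] ∷ bwd M ∷ fwd [ a ] ∷ []) []
    (width-z (length M) (length D) (length K)))
  (a≢b ∘ sym) y≢a (a≢b ∘ sym) z≢b z≢a
  where
  width-pair : ∀ μ δ → suc (suc (μ + δ)) ≡ suc (μ + suc (δ + 0))
  width-pair = solve-∀
  width-a : a ≡ suc (length M + suc (length D + 0))
  width-a = width-pair (length M) (length D)
  width-b : b ≡ suc (length K + suc (length D + 0))
  width-b = width-pair (length K) (length D)
  width-y : ∀ μ δ κ → suc (suc (suc (μ + δ)) + κ) ≡ suc (μ + suc (δ + suc (κ + 0)))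
  width-y = solve-∀
  width-z : ∀ μ δ κ → suc (suc (suc (suc (μ + δ)) + κ)) ≡ suc (κ + suc (δ + suc (μ + suc 0)))
  width-z = solve-∀

∈-range : ∀ {n k} → 1 ≤ k → k ≤ n → k ∈ map suc (upTo n)
∈-range {k = suc k} (s≤s z≤n) k<n = ∈-map⁺ suc (∈-upTo⁺ k<n)

length-range : ∀ n → length (map suc (upTo n)) ≡ n
length-range n = trans (length-map suc (upTo n)) (length-upTo n)

range-complement : ∀ {n ks} → Unique ks → All (λ k → 1 ≤ k × k ≤ n) ks →
                   ∃ λ F → IsPermOf n (ks ++ F) × length ks + length F ≡ n
range-complement {n} {ks} distinct bounds
  with F , perm ← unique-⊆⇒++-↭ distinct (All.map (λ (1≤k , k≤n) → ∈-range 1≤k k≤n) bounds)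
  = F , perm , trans (sym (length-++ ks)) (trans (↭-length perm) (length-range n))

-- Opaque: with-abstraction over a call of a transparent version unfolds the proof
-- and makes the checking of the callers very slow.
opaque
  free-values : ∀ {N a b} → a ≢ b → 1 ≤ a → a ≤ N → 1 ≤ b → b ≤ N →
    ∃ λ F → IsPermOf (suc (suc N)) (a ∷ b ∷ suc N ∷ suc (suc N) ∷ F) × suc (suc (length F)) ≡ N
  free-values {N} {a} {b} a≢b 1≤a a≤N 1≤b b≤N =
    Product.map₂ (Product.map₂ (suc-injective ∘ suc-injective)) (range-complement distinct bounds)
    where
    distinct : Unique (a ∷ b ∷ suc N ∷ suc (suc N) ∷ [])
    distinct = (a≢b ∷ <⇒≢ (s≤s a≤N) ∷ <⇒≢ (s≤s (m≤n⇒m≤1+n a≤N)) ∷ [])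
             ∷ (<⇒≢ (s≤s b≤N) ∷ <⇒≢ (s≤s (m≤n⇒m≤1+n b≤N)) ∷ [])
             ∷ (<⇒≢ (n<1+n (suc N)) ∷ []) ∷ [] ∷ []
    bounds : All (λ k → 1 ≤ k × k ≤ suc (suc N)) (a ∷ b ∷ suc N ∷ suc (suc N) ∷ [])
    bounds = (1≤a , m≤n⇒m≤o+n 2 a≤N) ∷ (1≤b , m≤n⇒m≤o+n 2 b≤N)
           ∷ (s≤s z≤n , n≤1+n (suc N)) ∷ (s≤s z≤n , ≤-refl) ∷ []

abxbax-valid : ∀ {N a b x} → a ≢ b → 1 ≤ a → a ≤ N → 1 ≤ b → b ≤ N → a + b ≡ suc N →
  x ≡ suc N ⊎ x ≡ suc (suc N) → TopdropValid (suc (suc N)) (a ∷ b ∷ x ∷ b ∷ a ∷ x ∷ [])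
abxbax-valid {N} {a@(suc α)} {b@(suc β)} {x} a≢b 1≤a a≤N 1≤b b≤N refl x≡ =
  from-complement (range-complement distinct bounds)
  where
  N<x : N < x
  N<x = Sum.[ (λ where refl → n<1+n N) , (λ where refl → m<n⇒m<1+n (n<1+n N)) ]′ x≡
  x≤2+N : x ≤ suc (suc N)
  x≤2+N = Sum.[ (λ where refl → n≤1+n (suc N)) , (λ where refl → ≤-refl) ]′ x≡
  a<x : a < x
  a<x = ≤-<-trans a≤N N<x
  b<x : b < x
  b<x = ≤-<-trans b≤N N<x
  distinct : Unique (a ∷ b ∷ x ∷ [])
  distinct = (a≢b ∷ <⇒≢ a<x ∷ []) ∷ (<⇒≢ b<x ∷ []) ∷ [] ∷ []
  bounds : All (λ k → 1 ≤ k × k ≤ suc (suc N)) (a ∷ b ∷ x ∷ [])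
  bounds = (1≤a , m≤n⇒m≤o+n 2 a≤N) ∷ (1≤b , m≤n⇒m≤o+n 2 b≤N) ∷ (≤-<-trans z≤n N<x , x≤2+N) ∷ []
  from-complement : (∃ λ F → IsPermOf (suc (suc N)) (a ∷ b ∷ x ∷ F) × 3 + length F ≡ suc (suc N)) →
                    TopdropValid (suc (suc N)) (a ∷ b ∷ x ∷ b ∷ a ∷ x ∷ [])
  from-complement (F , perm , |F|)
    with A , B , refl , |A| , |B| ← split-length F α β
           (suc-injective (trans (suc-injective (suc-injective |F|)) (+-suc α β)))
    = abxbax-orbit A B (cong suc (sym |A|)) (cong suc (sym |B|)) x≡ a≢b (>⇒≢ a<x) (>⇒≢ b<x)
        (↭-trans (solve 5 (λ a A b B x → a ⊕ A ⊕ b ⊕ B ⊕ x ⊜ a ⊕ b ⊕ x ⊕ A ⊕ B)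
                    ↭-refl [ a ] A [ b ] B [ x ]) perm)

abybaz-valid-small : ∀ {N a b} → a ≢ b → 1 ≤ a → a ≤ N → 1 ≤ b → b ≤ N → a + b < suc N →
  TopdropValid (suc (suc N)) (a ∷ b ∷ suc N ∷ b ∷ a ∷ suc (suc N) ∷ [])
abybaz-valid-small {N} {a@(suc α)} {b@(suc β)} a≢b 1≤a a≤N 1≤b b≤N (s≤s a+b≤N)
  with F , perm , |F| ← free-values a≢b 1≤a a≤N 1≤b b≤N
  with γ , refl ← m≤n⇒∃[o]m+o≡n a+b≤N
  with A , R , refl , refl , |R| ← split-length F α (β + γ)
         (suc-injective (suc-injective (trans |F| (trans (+-assoc a b γ) (cong suc (+-suc α (β + γ)))))))
  with B , C , refl , refl , refl ← split-length R β γ |R|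
  = abybaz-orbit-small A B C refl refl refl refl a≢b (>⇒≢ (s≤s a≤N))
      (>⇒≢ (s≤s (m≤n⇒m≤1+n a≤N))) (>⇒≢ (s≤s (m≤n⇒m≤1+n b≤N)))
      (↭-trans (solve 7 (λ a A b B y C z → a ⊕ A ⊕ b ⊕ B ⊕ y ⊕ C ⊕ z ⊜ a ⊕ b ⊕ y ⊕ z ⊕ A ⊕ B ⊕ C)
                  ↭-refl [ a ] A [ b ] B [ suc N ] C [ suc (suc N) ]) perm)

+-cancel-excess : ∀ {N u v w δ} → u + w ≡ N → suc (suc N) + δ ≡ u + v → v ≡ suc (suc (w + δ))
+-cancel-excess {u = u} {v} {w} {δ} refl 2+N+δ≡u+v = +-cancelˡ-≡ u v _ (begin
  u + v                    ≡⟨ 2+N+δ≡u+v ⟨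
  suc (suc (u + w)) + δ    ≡⟨ shift-sucs u w δ ⟩
  u + suc (suc (w + δ))    ∎)
  where
  open ≡-Reasoning
  shift-sucs : ∀ u w δ → suc (suc (u + w)) + δ ≡ u + suc (suc (w + δ))
  shift-sucs = solve-∀

-- μ, δ, κ are the lengths of the blocks M, D, K of abybaz-orbit-large.
large-sum-decomposition : ∀ {N a b} → a ≤ N → b ≤ N → suc N < a + b →
  ∃₂ λ μ δ → ∃ λ κ → a ≡ suc (suc (μ + δ)) × b ≡ suc (suc (κ + δ)) × a + κ ≡ N
large-sum-decomposition {a = a} {b} a≤N b≤N 1+N<a+b
  with κ , a+κ≡N ← m≤n⇒∃[o]m+o≡n a≤N
  with μ , b+μ≡N ← m≤n⇒∃[o]m+o≡n b≤N
  with δ , 2+N+δ≡a+b ← m≤n⇒∃[o]m+o≡n 1+N<a+b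
  = μ , δ , κ , +-cancel-excess b+μ≡N (trans 2+N+δ≡a+b (+-comm a b)) , +-cancel-excess a+κ≡N 2+N+δ≡a+b , a+κ≡N

abybaz-valid-large : ∀ {N a b} → a ≢ b → 1 ≤ a → a ≤ N → 1 ≤ b → b ≤ N → suc N < a + b →
  TopdropValid (suc (suc N)) (a ∷ b ∷ suc N ∷ b ∷ a ∷ suc (suc N) ∷ [])
abybaz-valid-large {N} {a} {b} a≢b 1≤a a≤N 1≤b b≤N 1+N<a+b
  with F , perm , |F| ← free-values a≢b 1≤a a≤N 1≤b b≤N
  with μ , δ , κ , refl , refl , refl ← large-sum-decomposition a≤N b≤N 1+N<a+b
  with R , K , refl , |R| , refl ← split-length F (μ + δ) κ (suc-injective (suc-injective |F|))
  with M , D , refl , refl , refl ← split-length R μ δ |R|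
  = abybaz-orbit-large M D K refl refl refl refl a≢b (>⇒≢ (s≤s a≤N))
      (>⇒≢ (s≤s (m≤n⇒m≤1+n a≤N))) (>⇒≢ (s≤s (m≤n⇒m≤1+n b≤N)))
      (↭-trans (solve 7 (λ a M y D b K z → a ⊕ M ⊕ y ⊕ D ⊕ b ⊕ K ⊕ z ⊜ a ⊕ b ⊕ y ⊕ z ⊕ (M ⊕ D) ⊕ K)
                  ↭-refl [ a ] M [ suc N ] D [ b ] K [ suc (suc N) ]) perm)

lemma4p9 : ∀ (n : ℕ) → 4 ≤ n → ∀ (a b : ℕ) → a ≢ b →
    1 ≤ a → a ≤ n ∸ 2 → 1 ≤ b → b ≤ n ∸ 2 →
    ((a + b ≡ n ∸ 1 →
        TopdropValid n (a ∷ b ∷ n ∷ b ∷ a ∷ n ∷ [])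
        × TopdropValid n (a ∷ b ∷ (n ∸ 1) ∷ b ∷ a ∷ (n ∸ 1) ∷ []))
    × (a + b ≢ n ∸ 1 →
        TopdropValid n (a ∷ b ∷ (n ∸ 1) ∷ b ∷ a ∷ n ∷ [])))
lemma4p9 (suc (suc N)) (s≤s (s≤s _)) a b a≢b 1≤a a≤N 1≤b b≤N = part-i , part-ii
  where
  part-i : a + b ≡ suc N → TopdropValid (suc (suc N)) (a ∷ b ∷ suc (suc N) ∷ b ∷ a ∷ suc (suc N) ∷ [])
                            × TopdropValid (suc (suc N)) (a ∷ b ∷ suc N ∷ b ∷ a ∷ suc N ∷ [])
  part-i a+b≡1+N = abxbax-valid a≢b 1≤a a≤N 1≤b b≤N a+b≡1+N (inj₂ refl)
                 , abxbax-valid a≢b 1≤a a≤N 1≤b b≤N a+b≡1+N (inj₁ refl)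
  part-ii : a + b ≢ suc N → TopdropValid (suc (suc N)) (a ∷ b ∷ suc N ∷ b ∷ a ∷ suc (suc N) ∷ [])
  part-ii a+b≢1+N with <-cmp (a + b) (suc N)
  ... | tri< a+b<1+N _ _ = abybaz-valid-small a≢b 1≤a a≤N 1≤b b≤N a+b<1+N
  ... | tri≈ _ a+b≡1+N _ = contradiction a+b≡1+N a+b≢1+N
  ... | tri> _ _ 1+N<a+b = abybaz-valid-large a≢b 1≤a a≤N 1≤b b≤N 1+N<a+b
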